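{- Let $w\in\mathfrak{S}_N$. If some $N$-occurrence of $321$ in $w$, consisting of the values $N>a>b$ appearing in this left-to-right order, satisfies $b\notin\{m_k(\overline{w}):\ k\in\mathrm{newrep}(w)\}$, then $w$ has an $N$-occurrence of $4321$.
   Context: Permutations are written in one-line notation; $s_i$ is the simple reflection interchanging $i$ and $i+1$; $\mathrm{supp}(u)$ is the set of distinct simple reflections appearing in a reduced decomposition of $u$. An occurrence of a pattern $p\in\mathfrak{S}_k$ in $w$ is a subsequence $w(i_1)\cdots w(i_k)$, $i_1<\cdots<i_k$, in the same relative order as $p$; it is an $N$-occurrence if its largest value is $N$. For $w\in\mathfrak{S}_N$, $\overline{w}\in\mathfrak{S}_{N-1}$ is obtained by deleting the letter $N$ from the one-line notation of $w$. For $u\in\mathfrak{S}_n$ and $1\le k\le n-1$, $m_k(u)=\min\{u(k+1),\dots,u(n)\}$. Let $\mathrm{newrep}(w)=\{k:\ s_k\in\mathrm{supp}(\overline{w}),\ w^{ -1}(N)\le k\}$. -}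

module Defs where

open import Data.Nat using (ℕ; zero; suc; _+_; _∸_; _≤_; _<_; _⊓_; _≡ᵇ_; _<?_)
open import Data.Bool using (if_then_else_)
open import Data.List using (List; []; _∷_; length; map; upTo; filter; foldl; foldr; drop)
open import Data.List.Relation.Unary.All using (All)
open import Data.List.Membership.Propositional using (_∈_)
open import Data.List.Relation.Binary.Permutation.Propositional using (_↭_)
open import Data.Product using (Σ; _×_)
open import Relation.Binary.PropositionalEquality using (_≡_)

-- Permutations of {1,…,N} in one-line notation, as lists of naturals.
range : ℕ → List ℕ
range n = map suc (upTo n)

IsPerm : List ℕ → Set
IsPerm w = w ↭ range (length w)

-- 1-based lookup w(i); returns 0 out of range (never used there).
at : List ℕ → ℕ → ℕ
at []       _             = 0
at (x ∷ xs) zero          = 0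
at (x ∷ xs) (suc zero)    = x
at (x ∷ xs) (suc (suc i)) = at xs (suc i)

-- 1-based position of a value in a list (w⁻¹(x) for a permutation).
indexOf : ℕ → List ℕ → ℕ
indexOf x []       = 0
indexOf x (y ∷ ys) = if x ≡ᵇ y then 1 else suc (indexOf x ys)

wbar : List ℕ → List ℕ
wbar w = filter (λ x → x <? length w) w

-- right multiplication by s_k: swap positions k and k+1 (1-based).
swapAt : ℕ → List ℕ → List ℕ
swapAt (suc zero)    (x ∷ y ∷ xs) = y ∷ x ∷ xs
swapAt (suc (suc k)) (x ∷ xs)     = x ∷ swapAt (suc k) xs
swapAt _             xs           = xs

-- the permutation s_{i₁} s_{i₂} ⋯ s_{iₗ} ∈ 𝔖_n in one-line notation
wordPerm : ℕ → List ℕ → List ℕ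
wordPerm n ws = foldl (λ u k → swapAt k u) (range n) ws

-- number of inversions = Coxeter length
inv : List ℕ → ℕ
inv []       = 0
inv (x ∷ xs) = length (filter (λ y → y <? x) xs) + inv xs

Reduced : List ℕ → List ℕ → Set
Reduced u ws =
  All (λ k → 1 ≤ k × k < length u) ws
  × wordPerm (length u) ws ≡ u
  × length ws ≡ inv u

InSupp : ℕ → List ℕ → Set
InSupp k u = Σ (List ℕ) λ ws → Reduced u ws × k ∈ ws

-- m_k(u) = min{u(k+1),…,u(n)} (list nonempty whenever k ≤ n-1)
mk : ℕ → List ℕ → ℕ
mk k u = foldr _⊓_ (suc (length u)) (drop k u)

InNewrep : List ℕ → ℕ → Set
InNewrep w k = InSupp k (wbar w) × indexOf (length w) w ≤ k

-- Write w = P N Q b R with the occurrence N > a > b, a in Q. If some letter of R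
-- is smaller than b, it completes a 4321. Otherwise b is the minimum of everything to the right
-- of position k = |P| + |Q| in w̄ = P Q b R, i.e. b = m_k(w̄); the inversion (a, b) straddles
-- position k, which forces s_k into the support of w̄; and N sits to the left of k + 1 because
-- Q is nonempty. So k ∈ newrep(w) and b = m_k(w̄), contradicting the hypothesis.
module Submission where

open import Defs
open import Data.Nat using (ℕ; zero; suc; _+_; _≤_; _<_; s≤s; z≤n; _<?_; _≟_; _⊓_; _≡ᵇ_)
open import Data.Nat.Properties
open import Algebra.Properties.CommutativeSemigroup +-commutativeSemigroup using (x∙yz≈y∙xz)
open import Data.Bool using (true; false)
open import Data.List using (List; []; _∷_; length; map; upTo; filter; foldr; take; drop; _++_; [_])
open import Data.List.Properties
  using (foldl-++; length-++; ++-assoc; map-++; upTo-∷ʳ; filter-accept; filter-reject; filter-all; filter-none; filter-++)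
open import Data.List.Relation.Unary.All as All using (All; []; _∷_)
import Data.List.Relation.Unary.All.Properties as All
open import Data.List.Relation.Unary.AllPairs using (AllPairs; []; _∷_)
open import Data.List.Relation.Unary.Linked using ([]; [-]; _∷_)
open import Data.List.Relation.Unary.Sorted.TotalOrder ≤-totalOrder using (Sorted)
open import Data.List.Relation.Unary.Sorted.TotalOrder.Properties using (Sorted⇒AllPairs; map⁺; applyUpTo⁺₂; ↗↭↗⇒≋)
open import Data.List.Relation.Unary.Any using (here; there)
open import Data.List.Relation.Binary.Equality.Propositional using (≋⇒≡)
open import Data.List.Membership.Propositional using (_∈_)
open import Data.List.Membership.Propositional.Properties using (∈-map⁻; ∈-upTo⁻; ∈-++⁺ˡ; ∈-++⁺ʳ)
open import Data.List.Relation.Binary.Permutation.Propositional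
  using (_↭_; refl; prep; swap; ↭-sym; ↭-trans; ↭-reflexive; ↭⇒↭ₛ; module PermutationReasoning)
open import Data.List.Relation.Binary.Permutation.Propositional.Properties
  using (∈-resp-↭; drop-∷; shift; ∷↭∷ʳ; ↭-length; filter-↭)
open import Data.Product using (Σ; ∃₂; _×_; _,_; proj₁; proj₂)
open import Data.Sum using (_⊎_; inj₁; inj₂)
open import Data.Empty using (⊥; ⊥-elim)
open import Function using (_∘_)
open import Relation.Nullary using (yes; no)
open import Relation.Binary.PropositionalEquality
  using (_≡_; _≢_; refl; sym; trans; cong; cong₂; subst; subst₂; module ≡-Reasoning)

Descent : ℕ → List ℕ → Set
Descent (suc zero)    (x ∷ y ∷ xs) = y < x
Descent (suc (suc d)) (x ∷ xs)     = Descent (suc d) xs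
Descent _             _            = ⊥

descent-bounds : ∀ d u → Descent d u → 1 ≤ d × d < length u
descent-bounds (suc zero)    (x ∷ y ∷ xs) _   = s≤s z≤n , s≤s (s≤s z≤n)
descent-bounds (suc (suc d)) (x ∷ xs)     dsc with descent-bounds (suc d) xs dsc
... | _ , d<n = s≤s z≤n , s≤s d<n

swapAt-involutive : ∀ d u → swapAt d (swapAt d u) ≡ u
swapAt-involutive zero          u            = refl
swapAt-involutive (suc zero)    []           = refl
swapAt-involutive (suc zero)    (x ∷ [])     = refl
swapAt-involutive (suc zero)    (x ∷ y ∷ xs) = refl
swapAt-involutive (suc (suc d)) []           = refl
swapAt-involutive (suc (suc d)) (x ∷ xs)     = cong (x ∷_) (swapAt-involutive (suc d) xs)

swapAt-↭ : ∀ d u → swapAt d u ↭ u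
swapAt-↭ zero          u            = refl
swapAt-↭ (suc zero)    []           = refl
swapAt-↭ (suc zero)    (x ∷ [])     = refl
swapAt-↭ (suc zero)    (x ∷ y ∷ xs) = swap y x refl
swapAt-↭ (suc (suc d)) []           = refl
swapAt-↭ (suc (suc d)) (x ∷ xs)     = prep x (swapAt-↭ (suc d) xs)

length-swapAt : ∀ d u → length (swapAt d u) ≡ length u
length-swapAt d u = ↭-length (swapAt-↭ d u)

IsPerm-swapAt : ∀ d u → IsPerm u → IsPerm (swapAt d u)
IsPerm-swapAt d u p = subst (λ n → swapAt d u ↭ range n) (sym (length-swapAt d u)) (↭-trans (swapAt-↭ d u) p)

take-swapAt-↭ : ∀ d k u → d ≢ k → take k (swapAt d u) ↭ take k u
take-swapAt-↭ d             zero          u            _   = refl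
take-swapAt-↭ zero          (suc k)       u            _   = refl
take-swapAt-↭ (suc zero)    (suc k)       []           _   = refl
take-swapAt-↭ (suc zero)    (suc k)       (x ∷ [])     _   = refl
take-swapAt-↭ (suc zero)    (suc zero)    (x ∷ y ∷ xs) 1≢1 = ⊥-elim (1≢1 refl)
take-swapAt-↭ (suc zero)    (suc (suc k)) (x ∷ y ∷ xs) _   = swap y x refl
take-swapAt-↭ (suc (suc d)) (suc k)       []           _   = refl
take-swapAt-↭ (suc (suc d)) (suc k)       (x ∷ xs)     d≢k = prep x (take-swapAt-↭ (suc d) k xs (d≢k ∘ cong suc))

drop-swapAt-↭ : ∀ d k u → d ≢ k → drop k (swapAt d u) ↭ drop k u
drop-swapAt-↭ d             zero          u            _   = swapAt-↭ d u
drop-swapAt-↭ zero          (suc k)       u            _   = refl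
drop-swapAt-↭ (suc zero)    (suc k)       []           _   = refl
drop-swapAt-↭ (suc zero)    (suc k)       (x ∷ [])     _   = refl
drop-swapAt-↭ (suc zero)    (suc zero)    (x ∷ y ∷ xs) 1≢1 = ⊥-elim (1≢1 refl)
drop-swapAt-↭ (suc zero)    (suc (suc k)) (x ∷ y ∷ xs) _   = refl
drop-swapAt-↭ (suc (suc d)) (suc k)       []           _   = refl
drop-swapAt-↭ (suc (suc d)) (suc k)       (x ∷ xs)     d≢k = drop-swapAt-↭ (suc d) k xs (d≢k ∘ cong suc)

length-filter-↭ : ∀ z {xs ys} → xs ↭ ys → length (filter (_<? z) xs) ≡ length (filter (_<? z) ys)
length-filter-↭ z = ↭-length ∘ filter-↭ (_<? z)

inv-swapAt-descent : ∀ d u → Descent d u → suc (inv (swapAt d u)) ≡ inv u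
inv-swapAt-descent (suc zero) (x ∷ y ∷ xs) y<x
  rewrite filter-reject (_<? y) {x} {xs} (<⇒≯ y<x) | filter-accept (_<? x) {y} {xs} y<x
  = cong suc (x∙yz≈y∙xz (length (filter (_<? y) xs)) (length (filter (_<? x) xs)) (inv xs))
inv-swapAt-descent (suc (suc d)) (x ∷ xs) dsc
  rewrite length-filter-↭ x (swapAt-↭ (suc d) xs)
  = trans (sym (+-suc _ _)) (cong (length (filter (_<? x) xs) +_) (inv-swapAt-descent (suc d) xs dsc))

descent-or-sorted : ∀ u → (Σ ℕ λ d → Descent d u) ⊎ Sorted u
descent-or-sorted []           = inj₂ []
descent-or-sorted (x ∷ [])     = inj₂ [-]
descent-or-sorted (x ∷ y ∷ xs) with y <? x | descent-or-sorted (y ∷ xs)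
... | yes y<x | _                   = inj₁ (1 , y<x)
... | no  _   | inj₁ (zero , ())
... | no  _   | inj₁ (suc d , dsc)  = inj₁ (suc (suc d) , dsc)
... | no  y≮x | inj₂ sorted         = inj₂ (≮⇒≥ y≮x ∷ sorted)

sorted⇒inv≡0 : ∀ {u} → Sorted u → inv u ≡ 0
sorted⇒inv≡0 = go ∘ Sorted⇒AllPairs ≤-totalOrder
  where
  go : ∀ {u} → AllPairs _≤_ u → inv u ≡ 0
  go []                 = refl
  go {x ∷ xs} (x≤ ∷ xs≤) rewrite filter-none (_<? x) (All.map ≤⇒≯ x≤) = go xs≤

sorted⇒no-inversion : ∀ k {u x y} → Sorted u → x ∈ take k u → y ∈ drop k u → x ≤ y
sorted⇒no-inversion k = go k ∘ Sorted⇒AllPairs ≤-totalOrder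
  where
  ∈-drop : ∀ {y : ℕ} k xs → y ∈ drop k xs → y ∈ xs
  ∈-drop zero    xs       y∈ = y∈
  ∈-drop (suc k) (x ∷ xs) y∈ = there (∈-drop k xs y∈)
  go : ∀ k {u x y} → AllPairs _≤_ u → x ∈ take k u → y ∈ drop k u → x ≤ y
  go (suc k) {z ∷ zs} (z≤ ∷ _)   (here refl) y∈ = All.lookup z≤ (∈-drop k zs y∈)
  go (suc k) {z ∷ zs} (_  ∷ zs≤) (there x∈)  y∈ = go k zs≤ x∈ y∈

range-sorted : ∀ n → Sorted (range n)
range-sorted n = map⁺ ≤-totalOrder ≤-totalOrder s≤s (applyUpTo⁺₂ ≤-totalOrder (λ i → i) n n≤1+n)

sorted-perm⇒range : ∀ {u} → IsPerm u → Sorted u → u ≡ range (length u)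
sorted-perm⇒range {u} perm sorted = ≋⇒≡ (↗↭↗⇒≋ ≤-totalOrder sorted (range-sorted (length u)) (↭⇒↭ₛ perm))

InversionAcross : ℕ → List ℕ → Set
InversionAcross k u = ∃₂ λ x y → x ∈ take k u × y ∈ drop k u × y < x

InversionAcross-swapAt : ∀ d k u → d ≢ k → InversionAcross k u → InversionAcross k (swapAt d u)
InversionAcross-swapAt d k u d≢k (x , y , x∈ , y∈ , y<x) =
  x , y , ∈-resp-↭ (↭-sym (take-swapAt-↭ d k u d≢k)) x∈ , ∈-resp-↭ (↭-sym (drop-swapAt-↭ d k u d≢k)) y∈ , y<x

Reduced-snoc : ∀ d u ws → Descent d u → Reduced (swapAt d u) ws → Reduced u (ws ++ [ d ])
Reduced-snoc d u ws dsc (letters , word , len) =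
  All.++⁺ (subst (λ n → All (λ k → 1 ≤ k × k < n) ws) (length-swapAt d u) letters) (descent-bounds d u dsc ∷ []) ,
  (begin
    wordPerm (length u) (ws ++ [ d ])              ≡⟨ foldl-++ (λ v k → swapAt k v) (range (length u)) ws [ d ] ⟩
    swapAt d (wordPerm (length u) ws)              ≡⟨ cong (λ n → swapAt d (wordPerm n ws)) (sym (length-swapAt d u)) ⟩
    swapAt d (wordPerm (length (swapAt d u)) ws)   ≡⟨ cong (swapAt d) word ⟩
    swapAt d (swapAt d u)                          ≡⟨ swapAt-involutive d u ⟩
    u                                              ∎) ,
  trans (length-++ ws) (trans (+-comm (length ws) 1) (trans (cong suc len) (inv-swapAt-descent d u dsc)))
  where open ≡-Reasoning

ReducedWordCoveringInversions : List ℕ → Set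
ReducedWordCoveringInversions u = Σ (List ℕ) λ ws → Reduced u ws × (∀ {k} → InversionAcross k u → k ∈ ws)

-- Bubble sort read backwards: each step swaps a descent d, removing one inversion, and appends
-- s_d; an inversion across k survives every swap with d ≢ k, so s_k is appended at some point.
reduced-word : ∀ u → IsPerm u → ReducedWordCoveringInversions u
reduced-word u = go (inv u) u refl
  where
  go : ∀ m u → inv u ≡ m → IsPerm u → ReducedWordCoveringInversions u
  go m u inv≡m perm with descent-or-sorted u
  ... | inj₂ sorted =
    [] , ([] , sym (sorted-perm⇒range perm sorted) , sym (sorted⇒inv≡0 sorted)) ,
    λ { {k} (_ , _ , x∈ , y∈ , y<x) → ⊥-elim (≤⇒≯ (sorted⇒no-inversion k sorted x∈ y∈) y<x) }
  go zero    u inv≡0 perm | inj₁ (d , dsc) with () ← trans (inv-swapAt-descent d u dsc) inv≡0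
  go (suc m) u inv≡m perm | inj₁ (d , dsc)
    with ws , reduced , covers ← go m (swapAt d u) (suc-injective (trans (inv-swapAt-descent d u dsc) inv≡m))
                                   (IsPerm-swapAt d u perm)
    = ws ++ [ d ] , Reduced-snoc d u ws dsc reduced , through
    where
    through : ∀ {k} → InversionAcross k u → k ∈ ws ++ [ d ]
    through {k} inversion with d ≟ k
    ... | yes refl = ∈-++⁺ʳ ws (here refl)
    ... | no  d≢k  = ∈-++⁺ˡ (covers (InversionAcross-swapAt d k u d≢k inversion))

InversionAcross⇒InSupp : ∀ {k u} → IsPerm u → InversionAcross k u → InSupp k u
InversionAcross⇒InSupp {u = u} perm inversion with ws , reduced , covers ← reduced-word u perm =
  ws , reduced , covers inversion

∈-perm-≤ : ∀ {u x} → IsPerm u → x ∈ u → x ≤ length u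
∈-perm-≤ perm x∈ with _ , y∈ , refl ← ∈-map⁻ suc (∈-resp-↭ perm x∈) = ∈-upTo⁻ y∈

range-suc-↭ : ∀ n → range (suc n) ↭ suc n ∷ range n
range-suc-↭ n = ↭-trans (↭-reflexive (trans (cong (map suc) (sym (upTo-∷ʳ n))) (map-++ suc (upTo n) [ n ])))
                        (↭-sym (∷↭∷ʳ (suc n) (range n)))

delete-max : ∀ {w} P S → IsPerm w → w ≡ P ++ length w ∷ S → IsPerm (P ++ S) × wbar w ≡ P ++ S
delete-max {w} P S perm w≡ = perm′ , wbar≡
  where
  N n : ℕ
  N = length w
  n = length (P ++ S)
  N≡ : N ≡ suc n
  N≡ = trans (cong length w≡) (↭-length (shift N P S))
  perm′ : IsPerm (P ++ S)
  perm′ = drop-∷ (begin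
    suc n ∷ P ++ S   ↭⟨ shift (suc n) P S ⟨
    P ++ suc n ∷ S   ≡⟨ cong (λ x → P ++ x ∷ S) N≡ ⟨
    P ++ N ∷ S       ≡⟨ w≡ ⟨
    w                ↭⟨ perm ⟩
    range N          ≡⟨ cong range N≡ ⟩
    range (suc n)    ↭⟨ range-suc-↭ n ⟩
    suc n ∷ range n  ∎)
    where open PermutationReasoning
  below : ∀ {x} → x ∈ P ++ S → x < N
  below x∈ = subst (_ <_) (sym N≡) (s≤s (∈-perm-≤ perm′ x∈))
  wbar≡ : wbar w ≡ P ++ S
  wbar≡ = begin
    filter (_<? N) w                             ≡⟨ cong (filter (_<? N)) w≡ ⟩
    filter (_<? N) (P ++ N ∷ S)                  ≡⟨ filter-++ (_<? N) P (N ∷ S) ⟩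
    filter (_<? N) P ++ filter (_<? N) (N ∷ S)   ≡⟨ cong (filter (_<? N) P ++_) (filter-reject (_<? N) (n≮n N)) ⟩
    filter (_<? N) P ++ filter (_<? N) S         ≡⟨ cong₂ _++_ (filter-all (_<? N) (All.tabulate (below ∘ ∈-++⁺ˡ)))
                                                               (filter-all (_<? N) (All.tabulate (below ∘ ∈-++⁺ʳ P))) ⟩
    P ++ S                                       ∎
    where open ≡-Reasoning

take-length-++ : ∀ (L R : List ℕ) → take (length L) (L ++ R) ≡ L
take-length-++ []      R = refl
take-length-++ (x ∷ L) R = cong (x ∷_) (take-length-++ L R)

drop-length-++ : ∀ (L R : List ℕ) → drop (length L) (L ++ R) ≡ R
drop-length-++ []      R = refl
drop-length-++ (x ∷ L) R = drop-length-++ L R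

indexOf-≤ : ∀ x P S → indexOf x (P ++ x ∷ S) ≤ suc (length P)
indexOf-≤ x []      S with x ≡ᵇ x | ≡⇒≡ᵇ x x refl
... | true | _ = ≤-refl
indexOf-≤ x (y ∷ P) S with x ≡ᵇ y
... | true  = s≤s z≤n
... | false = s≤s (indexOf-≤ x P S)

foldr-⊓-≥ : ∀ {b} z xs → All (b ≤_) xs → b ≤ z → b ≤ foldr _⊓_ z xs
foldr-⊓-≥ z []       []         b≤z = b≤z
foldr-⊓-≥ z (x ∷ xs) (b≤x ∷ b≤) b≤z = ⊓-glb b≤x (foldr-⊓-≥ z xs b≤ b≤z)

mk-suffix-min : ∀ L b R → All (b ≤_) R → b ≤ suc (length (L ++ b ∷ R)) → mk (length L) (L ++ b ∷ R) ≡ b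
mk-suffix-min L b R b≤R b≤ =
  trans (cong (foldr _⊓_ _) (drop-length-++ L (b ∷ R))) (m≤n⇒m⊓n≡m (foldr-⊓-≥ _ R b≤R b≤))

suffix-min-in-newrep : ∀ {w} P Q R {a b} → IsPerm w → w ≡ P ++ length w ∷ Q ++ b ∷ R →
  a ∈ Q → b < a → All (b ≤_) R → InNewrep w (length (P ++ Q)) × mk (length (P ++ Q)) (wbar w) ≡ b
suffix-min-in-newrep {w} P Q R {a} {b} perm w≡ a∈Q b<a b≤R = (supp , position) , b-is-min
  where
  L : List ℕ
  L = P ++ Q
  k : ℕ
  k = length L
  deleted : IsPerm (P ++ Q ++ b ∷ R) × wbar w ≡ P ++ Q ++ b ∷ R
  deleted = delete-max P (Q ++ b ∷ R) perm w≡
  wbar≡ : wbar w ≡ L ++ b ∷ R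
  wbar≡ = trans (proj₂ deleted) (sym (++-assoc P Q (b ∷ R)))
  perm′ : IsPerm (L ++ b ∷ R)
  perm′ = subst IsPerm (sym (++-assoc P Q (b ∷ R))) (proj₁ deleted)
  inversion : InversionAcross k (L ++ b ∷ R)
  inversion = a , b , subst (a ∈_) (sym (take-length-++ L (b ∷ R))) (∈-++⁺ʳ P a∈Q)
                    , subst (b ∈_) (sym (drop-length-++ L (b ∷ R))) (here refl) , b<a
  supp : InSupp k (wbar w)
  supp = subst (InSupp k) (sym wbar≡) (InversionAcross⇒InSupp perm′ inversion)
  nonempty : ∀ {xs : List ℕ} → a ∈ xs → 1 ≤ length xs
  nonempty {_ ∷ _} _ = s≤s z≤n
  position : indexOf (length w) w ≤ k
  position = subst (λ v → indexOf (length w) v ≤ k) (sym w≡)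
    (≤-trans (indexOf-≤ (length w) P (Q ++ b ∷ R))
      (subst₂ _≤_ (+-comm (length P) 1) (sym (length-++ P)) (+-monoʳ-≤ (length P) (nonempty a∈Q))))
  b-is-min : mk k (wbar w) ≡ b
  b-is-min = trans (cong (mk k) wbar≡)
    (mk-suffix-min L b R b≤R (m≤n⇒m≤1+n (∈-perm-≤ perm′ (∈-++⁺ʳ L (here refl)))))

split-at : ∀ xs {l} → 1 ≤ l → l ≤ length xs → Σ (List ℕ) λ Q → xs ≡ Q ++ at xs l ∷ drop l xs
split-at (x ∷ xs) {suc zero}    _ _          = [] , refl
split-at (x ∷ xs) {suc (suc l)} _ (s≤s l≤n) with Q , xs≡ ← split-at xs {suc l} (s≤s z≤n) l≤n =
  x ∷ Q , cong (x ∷_) xs≡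

split-before : ∀ xs {j l} → 1 ≤ j → j < l → l ≤ length xs →
  Σ (List ℕ) λ Q → xs ≡ Q ++ at xs l ∷ drop l xs × at xs j ∈ Q
split-before (x ∷ xs) {suc zero} {suc zero}    _ (s≤s ()) _
split-before (x ∷ xs) {suc zero} {suc (suc l)} _ _ (s≤s l≤n) with Q , xs≡ ← split-at xs {suc l} (s≤s z≤n) l≤n =
  x ∷ Q , cong (x ∷_) xs≡ , here refl
split-before (x ∷ xs) {suc (suc j)} {suc (suc l)} _ (s≤s j<l) (s≤s l≤n)
  with Q , xs≡ , xⱼ∈Q ← split-before xs {suc j} {suc l} (s≤s z≤n) j<l l≤n =
  x ∷ Q , cong (x ∷_) xs≡ , there xⱼ∈Q

split-around : ∀ xs {i j l} → 1 ≤ i → i < j → j < l → l ≤ length xs →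
  Σ (List ℕ) λ P → Σ (List ℕ) λ Q → xs ≡ P ++ at xs i ∷ Q ++ at xs l ∷ drop l xs × at xs j ∈ Q
split-around (x ∷ xs) {suc zero} {suc zero}    _ (s≤s ()) _ _
split-around (x ∷ xs) {suc zero} {suc (suc j)} {suc (suc l)} _ _ (s≤s j<l) (s≤s l≤n)
  with Q , xs≡ , xⱼ∈Q ← split-before xs {suc j} {suc l} (s≤s z≤n) j<l l≤n =
  [] , Q , cong (x ∷_) xs≡ , xⱼ∈Q
split-around (x ∷ xs) {suc (suc i)} {suc (suc j)} {suc (suc l)} _ (s≤s i<j) (s≤s j<l) (s≤s l≤n)
  with P , Q , xs≡ , xⱼ∈Q ← split-around xs {suc i} {suc j} {suc l} (s≤s z≤n) i<j j<l l≤n =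
  x ∷ P , Q , cong (x ∷_) xs≡ , xⱼ∈Q

smaller-after-or-suffix-≥ : ∀ b xs l →
  (Σ ℕ λ p → l < p × p ≤ length xs × at xs p < b) ⊎ All (b ≤_) (drop l xs)
smaller-after-or-suffix-≥ b []       zero    = inj₂ []
smaller-after-or-suffix-≥ b []       (suc l) = inj₂ []
smaller-after-or-suffix-≥ b (x ∷ xs) zero    with x <? b | smaller-after-or-suffix-≥ b xs zero
... | yes x<b | _                                   = inj₁ (1 , s≤s z≤n , s≤s z≤n , x<b)
... | no  _   | inj₁ (suc p , _ , p≤n , xₚ<b)       = inj₁ (suc (suc p) , s≤s z≤n , s≤s p≤n , xₚ<b)
... | no  x≮b | inj₂ b≤xs                           = inj₂ (≮⇒≥ x≮b ∷ b≤xs)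
smaller-after-or-suffix-≥ b (x ∷ xs) (suc l) with smaller-after-or-suffix-≥ b xs l
... | inj₁ (suc p , l<p , p≤n , xₚ<b) = inj₁ (suc (suc p) , s≤s l<p , s≤s p≤n , xₚ<b)
... | inj₂ b≤drop                     = inj₂ b≤drop

proposition4p2p1 : ∀ w → IsPerm w →
    ∀ i j l → 1 ≤ i → i < j → j < l → l ≤ length w →
    at w i ≡ length w → at w l < at w j →
    (∀ k → InNewrep w k → at w l ≢ mk k (wbar w)) →
    Σ ℕ λ p₁ → Σ ℕ λ p₂ → Σ ℕ λ p₃ → Σ ℕ λ p₄ →
      1 ≤ p₁ × p₁ < p₂ × p₂ < p₃ × p₃ < p₄ × p₄ ≤ length w ×
      at w p₁ ≡ length w × at w p₄ < at w p₃ × at w p₃ < at w p₂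
proposition4p2p1 w perm i j l 1≤i i<j j<l l≤n wᵢ≡N b<a b∉mins
  with smaller-after-or-suffix-≥ (at w l) w l
... | inj₁ (p , l<p , p≤n , wₚ<b) = i , j , l , p , 1≤i , i<j , j<l , l<p , p≤n , wᵢ≡N , wₚ<b , b<a
... | inj₂ b≤suffix with P , Q , w≡ , a∈Q ← split-around w 1≤i i<j j<l l≤n
  with newrep , b≡mk ← suffix-min-in-newrep P Q (drop l w) perm
                         (subst (λ x → w ≡ P ++ x ∷ Q ++ at w l ∷ drop l w) wᵢ≡N w≡) a∈Q b<a b≤suffix
  = ⊥-elim (b∉mins _ newrep (sym b≡mk))
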